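{- The logic $\mathbf{QML}$ is decidable: there is an algorithm which, given any formula $\alpha$ of $\mathbf{QML}$, determines in finitely many steps whether the sequent $\vdash \alpha$ (empty left-hand side) is derivable in the sequent calculus of $\mathbf{QML}$.
   Context: Formulas of $\mathbf{QML}$ are built from a countable set of atomic formulas $p,q,\dots$ using $\wedge$, $\neg$ and the unary modal operator $\Box$. A sequent is an expression $\Gamma\vdash\Delta$ with $\Gamma,\Delta$ finite (possibly empty) sets of formulas; $\alpha,\Gamma$ denotes $\{\alpha\}\cup\Gamma$, $\Gamma,\Delta$ denotes $\Gamma\cup\Delta$, $\neg\Gamma=\{\neg\gamma:\gamma\in\Gamma\}$, $\Box\Gamma=\{\Box\gamma:\gamma\in\Gamma\}$. The sequent calculus of $\mathbf{QML}$ has axioms (AX) $\alpha\vdash\alpha$ and (MEM) $\Gamma\vdash\Box\alpha,\neg\Box\alpha$, and rules (each written "upper sequent(s) / lower sequent"): (WKN) from $\Gamma\vdash\Delta$ infer $\Pi,\Gamma\vdash\Delta,\Sigma$; (CUT) from $\Gamma_1\vdash\Delta_1,\alpha$ and $\alpha,\Gamma_2\vdash\Delta_2$ infer $\Gamma_1,\Gamma_2\vdash\Delta_1,\Delta_2$; ($\wedge$l$_1$) from $\alpha,\Gamma\vdash\Delta$ infer $\alpha\wedge\beta,\Gamma\vdash\Delta$; ($\wedge$l$_2$) from $\beta,\Gamma\vdash\Delta$ infer $\alpha\wedge\beta,\Gamma\vdash\Delta$; ($\wedge$r) from $\Gamma\vdash\Delta,\alpha$ and $\Gamma\vdash\Delta,\beta$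 infer $\Gamma\vdash\Delta,\alpha\wedge\beta$; ($\neg$l) from $\Gamma\vdash\Delta,\alpha$ infer $\neg\alpha,\Gamma\vdash\Delta$; ($\neg$r) from $\alpha\vdash\Delta$ infer $\neg\Delta\vdash\neg\alpha$; ($\neg\neg$l) from $\alpha,\Gamma\vdash\Delta$ infer $\neg\neg\alpha,\Gamma\vdash\Delta$; ($\neg\neg$r) from $\Gamma\vdash\Delta,\alpha$ infer $\Gamma\vdash\Delta,\neg\neg\alpha$; (K) from $\Gamma\vdash\alpha$ infer $\Box\Gamma\vdash\Box\alpha$. A derivation is a finite sequence of sequents each of which is an axiom or the lower sequent of a rule whose upper sequents occur earlier; a sequent is derivable if it is the last element of some derivation. -}

module Defs where

open import Data.Nat using (ℕ)
open import Data.List using (List; []; _∷_; _++_; map)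
open import Data.List.Membership.Propositional using (_∈_)
open import Data.Product using (_×_)

data Formula : Set where
  atom : ℕ → Formula
  _∧_  : Formula → Formula → Formula
  ¬_   : Formula → Formula
  □_   : Formula → Formula

infixr 6 _∧_
infix  7 ¬_ □_

-- Finite sets of formulas are represented by lists, identified up to
-- having the same members (set equality).
_≋_ : List Formula → List Formula → Set
Γ ≋ Δ = ∀ φ → (φ ∈ Γ → φ ∈ Δ) × (φ ∈ Δ → φ ∈ Γ)

¬* : List Formula → List Formula
¬* = map ¬_

□* : List Formula → List Formula
□* = map □_

-- Derivability in the sequent calculus of QML.  The rule `set` expresses
-- that sequents are pairs of *sets*: lists with the same members denote
-- the same sequent.
data _⊢_ : List Formula → List Formula → Set where
  set  : ∀ {Γ Δ Γ' Δ'} → Γ ⊢ Δ → Γ ≋ Γ' → Δ ≋ Δ' → Γ' ⊢ Δ'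
  ax   : ∀ {α} → (α ∷ []) ⊢ (α ∷ [])
  mem  : ∀ {Γ α} → Γ ⊢ (□ α ∷ ¬ □ α ∷ [])
  wkn  : ∀ {Γ Δ Π Σ} → Γ ⊢ Δ → (Π ++ Γ) ⊢ (Δ ++ Σ)
  cut  : ∀ {Γ₁ Δ₁ Γ₂ Δ₂ α} → Γ₁ ⊢ (Δ₁ ++ α ∷ []) → (α ∷ Γ₂) ⊢ Δ₂
       → (Γ₁ ++ Γ₂) ⊢ (Δ₁ ++ Δ₂)
  ∧l₁  : ∀ {α β Γ Δ} → (α ∷ Γ) ⊢ Δ → (α ∧ β ∷ Γ) ⊢ Δ
  ∧l₂  : ∀ {α β Γ Δ} → (β ∷ Γ) ⊢ Δ → (α ∧ β ∷ Γ) ⊢ Δ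
  ∧r   : ∀ {α β Γ Δ} → Γ ⊢ (Δ ++ α ∷ []) → Γ ⊢ (Δ ++ β ∷ [])
       → Γ ⊢ (Δ ++ α ∧ β ∷ [])
  ¬l   : ∀ {α Γ Δ} → Γ ⊢ (Δ ++ α ∷ []) → (¬ α ∷ Γ) ⊢ Δ
  ¬r   : ∀ {α Δ} → (α ∷ []) ⊢ Δ → ¬* Δ ⊢ (¬ α ∷ [])
  ¬¬l  : ∀ {α Γ Δ} → (α ∷ Γ) ⊢ Δ → (¬ ¬ α ∷ Γ) ⊢ Δ
  ¬¬r  : ∀ {α Γ Δ} → Γ ⊢ (Δ ++ α ∷ []) → Γ ⊢ (Δ ++ ¬ ¬ α ∷ [])
  K    : ∀ {Γ α} → Γ ⊢ (α ∷ []) → □* Γ ⊢ (□ α ∷ [])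

infix 4 _⊢_

module Submission where

-- Filtration by elimination.  Let C be the closure of α (its subformulas, with the negations
-- of its atoms and boxes), and call a split (S , T) of C a point.  Starting from all points,
-- repeatedly discard the points that are not coherent with the surviving ones: S does not
-- respect the connectives, or a formula outside S has no witness among the survivors.  Each
-- discarded point has a derivable sequent S ⊢ T, obtained from the failing condition by cutting
-- on all of C.  Once nothing more is discarded, the survivors form a finite model: two points
-- are orthogonal when one contains the negation of a formula of the other, y is accessible from
-- x when it contains every ψ with □ ψ in x, and on C truth coincides with membership in S.  The
-- calculus is sound for such models, so ⊢ α is derivable iff α lies in every surviving S.

open import Defs
open import Data.Nat as ℕ using (ℕ; suc; _<_; s≤s⁻¹)
open import Data.Nat.Properties using (<-≤-trans; ≤-refl)
open import Data.List using (List; []; _∷_; _++_; map; filter; length)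
open import Data.List.Properties using (++-identityʳ; filter-notAll)
open import Data.List.Membership.Propositional using (_∈_; _∉_; find; lose)
open import Data.List.Membership.Propositional.Properties
  using (∈-map⁺; ∈-map⁻; ∈-++⁺ˡ; ∈-++⁺ʳ; ∈-++⁻; ∈-filter⁺; ∈-filter⁻)
open import Data.List.Relation.Binary.Subset.Propositional using (_⊆_)
open import Data.List.Relation.Binary.Subset.Propositional.Properties
  using (⊆-reflexive; ⊆-reflexive-↭; xs⊆xs++ys; All-resp-⊇; Any-resp-⊆)
open import Data.List.Relation.Binary.Permutation.Propositional using (↭-sym)
open import Data.List.Relation.Binary.Permutation.Propositional.Properties using (shift)
open import Data.List.Relation.Unary.Any using (Any; here; there; any?)
open import Data.List.Relation.Unary.Any.Properties as Anyₚ using (singleton⁻)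
open import Data.List.Relation.Unary.All as All
  using (All; []; _∷_; all?; lookup; lookupWith; tabulate)
open import Data.List.Relation.Unary.All.Properties as Allₚ using (¬All⇒Any¬)
open import Data.Product as Product using (∃; _×_; _,_; proj₁; proj₂)
open import Data.Sum as Sum using (_⊎_; inj₁; inj₂; [_,_]′; reduce)
open import Data.Empty using (⊥-elim)
open import Function using (id; _∘_)
open import Function.Bundles using (_⇔_; mk⇔; module Equivalence)
open import Relation.Binary.Definitions using (Decidable; DecidableEquality)
open import Relation.Binary.PropositionalEquality using (refl; cong)
open import Relation.Nullary using (Dec; yes; no) renaming (¬_ to Not)
open import Relation.Nullary.Decidable using (map′; ¬?; _×-dec_; _⊎-dec_; _→-dec_)

open Equivalence using (to; from)

infix 4 _≟_

_≟_ : DecidableEquality Formula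
atom m ≟ atom n  = map′ (cong atom) (λ { refl → refl }) (m ℕ.≟ n)
a ∧ b  ≟ c ∧ d   = map′ (λ { (refl , refl) → refl }) (λ { refl → refl , refl }) (a ≟ c ×-dec b ≟ d)
¬ a    ≟ ¬ b     = map′ (cong ¬_) (λ { refl → refl }) (a ≟ b)
□ a    ≟ □ b     = map′ (cong □_) (λ { refl → refl }) (a ≟ b)
atom _ ≟ _ ∧ _   = no λ ()
atom _ ≟ ¬ _     = no λ ()
atom _ ≟ □ _     = no λ ()
_ ∧ _  ≟ atom _  = no λ ()
_ ∧ _  ≟ ¬ _     = no λ ()
_ ∧ _  ≟ □ _     = no λ ()
¬ _    ≟ atom _  = no λ ()
¬ _    ≟ _ ∧ _   = no λ ()
¬ _    ≟ □ _     = no λ ()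
□ _    ≟ atom _  = no λ ()
□ _    ≟ _ ∧ _   = no λ ()
□ _    ≟ ¬ _     = no λ ()

open import Data.List.Membership.DecPropositional _≟_ using (_∈?_)

module _ {A : Set} where

  xs++xs⊆xs : (xs : List A) → xs ++ xs ⊆ xs
  xs++xs⊆xs xs = reduce ∘ ∈-++⁻ xs

  Any-∷ʳ⁻ : ∀ {P : A → Set} xs {a} → Any P (xs ++ a ∷ []) → Any P xs ⊎ P a
  Any-∷ʳ⁻ xs = Sum.map₂ singleton⁻ ∘ Anyₚ.++⁻ xs

  All-⊎-const : ∀ {P : A → Set} {Q : Set} {xs} → All (λ x → P x ⊎ Q) xs → All P xs ⊎ Q
  All-⊎-const []             = inj₁ []
  All-⊎-const (inj₁ p ∷ pqs) = Sum.map₁ (p ∷_) (All-⊎-const pqs)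
  All-⊎-const (inj₂ q ∷ _)   = inj₂ q

  splits : List A → List (List A × List A)
  splits []      = ([] , []) ∷ []
  splits (a ∷ l) = map (Product.map₁ (a ∷_)) (splits l) ++ map (Product.map₂ (a ∷_)) (splits l)

  splits-⊆ : ∀ {L y} → y ∈ splits L → proj₁ y ⊆ L
  splits-⊆ {[]} (here refl) ()
  splits-⊆ {a ∷ L} y∈ with ∈-++⁻ (map (Product.map₁ (a ∷_)) (splits L)) y∈
  ... | inj₁ y∈ˡ with ∈-map⁻ (Product.map₁ (a ∷_)) y∈ˡ
  ...   | _ , z∈ , refl = λ { (here refl) → here refl ; (there b∈) → there (splits-⊆ z∈ b∈) }
  splits-⊆ {a ∷ L} y∈ | inj₂ y∈ʳ with ∈-map⁻ (Product.map₂ (a ∷_)) y∈ʳ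
  ...   | _ , z∈ , refl = there ∘ splits-⊆ z∈

  splits-cover : ∀ {L y} → y ∈ splits L → L ⊆ proj₁ y ++ proj₂ y
  splits-cover {[]} (here refl) ()
  splits-cover {a ∷ L} y∈ with ∈-++⁻ (map (Product.map₁ (a ∷_)) (splits L)) y∈
  ... | inj₁ y∈ˡ with ∈-map⁻ (Product.map₁ (a ∷_)) y∈ˡ
  ...   | _ , z∈ , refl = λ { (here refl) → here refl ; (there b∈) → there (splits-cover z∈ b∈) }
  splits-cover {a ∷ L} y∈ | inj₂ y∈ʳ with ∈-map⁻ (Product.map₂ (a ∷_)) y∈ʳ
  ...   | (S , T) , z∈ , refl = ⊆-reflexive-↭ (↭-sym (shift a S T)) ∘ λ
    { (here refl) → here refl ; (there b∈) → there (splits-cover z∈ b∈) }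

  splits-∉₁⇒∈₂ : ∀ {L y x} → y ∈ splits L → x ∈ L → x ∉ proj₁ y → x ∈ proj₂ y
  splits-∉₁⇒∈₂ {y = S , T} y∈ x∈L x∉S = [ ⊥-elim ∘ x∉S , id ]′ (∈-++⁻ S (splits-cover y∈ x∈L))

≋⇒⊆ : ∀ {Γ Δ} → Γ ≋ Δ → Γ ⊆ Δ
≋⇒⊆ Γ≋Δ {φ} = proj₁ (Γ≋Δ φ)

⊢-mono : ∀ {Γ Δ Γ′ Δ′} → Γ ⊢ Δ → Γ ⊆ Γ′ → Δ ⊆ Δ′ → Γ′ ⊢ Δ′
⊢-mono {Γ} {Δ} {Γ′} {Δ′} d Γ⊆Γ′ Δ⊆Δ′ = set (wkn {Π = Γ′} {Σ = Δ′} d) left right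
  where
  left : (Γ′ ++ Γ) ≋ Γ′
  left _ = [ id , Γ⊆Γ′ ]′ ∘ ∈-++⁻ Γ′ , ∈-++⁺ˡ
  right : (Δ ++ Δ′) ≋ Δ′
  right _ = [ Δ⊆Δ′ , id ]′ ∘ ∈-++⁻ Δ , ∈-++⁺ʳ Δ

⊢-select : ∀ {α β Γ Δ} → α ∷ [] ⊢ β ∷ [] → α ∈ Γ → β ∈ Δ → Γ ⊢ Δ
⊢-select d α∈Γ β∈Δ = ⊢-mono d (λ { (here refl) → α∈Γ }) (λ { (here refl) → β∈Δ })

⊢-init : ∀ {φ Γ Δ} → φ ∈ Γ → φ ∈ Δ → Γ ⊢ Δ
⊢-init = ⊢-select ax

⊢-cut : ∀ {α Γ Δ} → Γ ⊢ α ∷ Δ → α ∷ Γ ⊢ Δ → Γ ⊢ Δ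
⊢-cut {α} {Γ} {Δ} d e =
  ⊢-mono (cut {Γ₁ = Γ} {Δ₁ = Δ} (⊢-mono d id α∷Δ⊆Δ∷ʳα) e)
         (xs++xs⊆xs Γ) (xs++xs⊆xs Δ)
  where
  α∷Δ⊆Δ∷ʳα : α ∷ Δ ⊆ Δ ++ α ∷ []
  α∷Δ⊆Δ∷ʳα = λ { (here refl) → ∈-++⁺ʳ Δ (here refl) ; (there φ∈Δ) → ∈-++⁺ˡ φ∈Δ }

¬¬-elimˡ : ∀ {ψ Γ Δ} → ψ ∈ Γ → ¬ ¬ ψ ∷ Γ ⊢ Δ → Γ ⊢ Δ
¬¬-elimˡ ψ∈Γ = ⊢-cut (⊢-select (¬¬r {Δ = []} ax) ψ∈Γ (here refl))

¬¬-elimʳ : ∀ {φ Γ} → Γ ⊢ ¬ ¬ φ ∷ [] → Γ ⊢ φ ∷ []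
¬¬-elimʳ d =
  ⊢-cut (⊢-mono d id (xs⊆xs++ys _ _)) (⊢-select (¬¬l {Γ = []} ax) (here refl) (here refl))

¬¬*-elimˡ : ∀ {Γ Δ} P → P ⊆ Γ → ¬* (¬* P) ++ Γ ⊢ Δ → Γ ⊢ Δ
¬¬*-elimˡ []      _    d = d
¬¬*-elimˡ (ψ ∷ P) P⊆Γ d =
  ¬¬*-elimˡ P (P⊆Γ ∘ there) (¬¬-elimˡ (∈-++⁺ʳ (¬* (¬* P)) (P⊆Γ (here refl))) d)

contrapose : ∀ {φ Γ} → φ ∷ [] ⊢ ¬* Γ → Γ ⊢ ¬ φ ∷ []
contrapose {Γ = Γ} d = ¬¬*-elimˡ Γ id (⊢-mono (¬r d) (xs⊆xs++ys _ Γ) id)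

⊢-by-splits : ∀ L {Γ Δ} → (∀ {y} → y ∈ splits L → Γ ++ proj₁ y ⊢ Δ ++ proj₂ y) → Γ ⊢ Δ
⊢-by-splits [] {Γ} {Δ} h =
  ⊢-mono (h (here refl)) (⊆-reflexive (++-identityʳ Γ)) (⊆-reflexive (++-identityʳ Δ))
⊢-by-splits (a ∷ L) {Γ} {Δ} h = ⊢-cut (⊢-by-splits L a-right) (⊢-by-splits L a-left)
  where
  a-left : ∀ {y} → y ∈ splits L → a ∷ Γ ++ proj₁ y ⊢ Δ ++ proj₂ y
  a-left y∈ = ⊢-mono (h (∈-++⁺ˡ (∈-map⁺ _ y∈))) (⊆-reflexive-↭ (shift a Γ _)) id
  a-right : ∀ {y} → y ∈ splits L → Γ ++ proj₁ y ⊢ a ∷ Δ ++ proj₂ y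
  a-right y∈ = ⊢-mono (h (∈-++⁺ʳ _ (∈-map⁺ _ y∈))) id (⊆-reflexive-↭ (shift a Δ _))

closure : Formula → List Formula
closure (atom n) = atom n ∷ ¬ atom n ∷ []
closure (a ∧ b)  = a ∧ b ∷ closure a ++ closure b
closure (¬ a)    = ¬ a ∷ closure a
closure (□ a)    = □ a ∷ ¬ □ a ∷ closure a

closure-self : ∀ α → α ∈ closure α
closure-self (atom n) = here refl
closure-self (a ∧ b)  = here refl
closure-self (¬ a)    = here refl
closure-self (□ a)    = here refl

closure-⊆ : ∀ α {φ} → φ ∈ closure α → closure φ ⊆ closure α
closure-⊆ (atom n) (here refl)         = id
closure-⊆ (atom n) (there (here refl)) = λ { (here refl) → there (here refl) ; (there ψ∈) → ψ∈ }
closure-⊆ (a ∧ b)  (here refl)         = id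
closure-⊆ (a ∧ b)  (there φ∈) with ∈-++⁻ (closure a) φ∈
... | inj₁ φ∈a = there ∘ ∈-++⁺ˡ ∘ closure-⊆ a φ∈a
... | inj₂ φ∈b = there ∘ ∈-++⁺ʳ (closure a) ∘ closure-⊆ b φ∈b
closure-⊆ (¬ a)    (here refl)         = id
closure-⊆ (¬ a)    (there φ∈)          = there ∘ closure-⊆ a φ∈
closure-⊆ (□ a)    (here refl)         = id
closure-⊆ (□ a)    (there (here refl)) = λ { (here refl) → there (here refl) ; (there ψ∈) → ψ∈ }
closure-⊆ (□ a)    (there (there φ∈))  = there ∘ there ∘ closure-⊆ a φ∈

record Closed (C : List Formula) : Set where
  field
    ∧-closedˡ    : ∀ {a b} → a ∧ b ∈ C → a ∈ C
    ∧-closedʳ    : ∀ {a b} → a ∧ b ∈ C → b ∈ C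
    ¬-closed     : ∀ {a} → ¬ a ∈ C → a ∈ C
    □-closed     : ∀ {a} → □ a ∈ C → a ∈ C
    ¬atom-closed : ∀ {n} → atom n ∈ C → ¬ atom n ∈ C
    ¬□-closed    : ∀ {a} → □ a ∈ C → ¬ □ a ∈ C

closure-closed : ∀ α → Closed (closure α)
closure-closed α = record
  { ∧-closedˡ    = λ {a} φ∈ → closure-⊆ α φ∈ (there (∈-++⁺ˡ (closure-self a)))
  ; ∧-closedʳ    = λ {a} {b} φ∈ → closure-⊆ α φ∈ (there (∈-++⁺ʳ (closure a) (closure-self b)))
  ; ¬-closed     = λ {a} φ∈ → closure-⊆ α φ∈ (there (closure-self a))
  ; □-closed     = λ {a} φ∈ → closure-⊆ α φ∈ (there (there (closure-self a)))
  ; ¬atom-closed = λ φ∈ → closure-⊆ α φ∈ (there (here refl))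
  ; ¬□-closed    = λ φ∈ → closure-⊆ α φ∈ (there (here refl))
  }

module Semantics {P : Set} (W : List P) (_⟂_ _↝_ : P → P → Set) (V : ℕ → P → Set) where

  infix 4 _⊩_

  _⊩_ : P → Formula → Set
  x ⊩ atom n = V n x
  x ⊩ a ∧ b  = x ⊩ a × x ⊩ b
  x ⊩ ¬ a    = All (λ y → y ⊩ a → x ⟂ y) W
  x ⊩ □ a    = All (λ y → x ↝ y → y ⊩ a) W

  record IsOrthoModel : Set where
    field
      _⟂?_           : Decidable _⟂_
      _↝?_           : Decidable _↝_
      V?             : ∀ n x → Dec (V n x)
      ⟂-sym          : ∀ {x y} → x ⟂ y → y ⟂ x
      ⟂-irrefl       : ∀ {x} → x ∈ W → Not (x ⟂ x)
      -- validates MEM: a point refuting □ a is orthogonal to every point forcing □ a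
      ↝-⊆-or-⟂       : ∀ {x z} → x ∈ W → z ∈ W → (∀ {y} → x ↝ y → z ↝ y) ⊎ x ⟂ z
      -- extends to all formulas (⊩-¬¬-elim), which validates ¬¬l
      atom-¬¬-closed : ∀ {n x} → x ∈ W → x ⊩ ¬ ¬ atom n → x ⊩ atom n

  module _ (model : IsOrthoModel) where
    open IsOrthoModel model

    infix 4 _⊩?_

    _⊩?_ : ∀ x φ → Dec (x ⊩ φ)
    x ⊩? atom n = V? n x
    x ⊩? a ∧ b  = (x ⊩? a) ×-dec (x ⊩? b)
    x ⊩? ¬ a    = all? (λ y → (y ⊩? a) →-dec (x ⟂? y)) W
    x ⊩? □ a    = all? (λ y → (x ↝? y) →-dec (y ⊩? a)) W

    ⊩-¬-antitone : ∀ a b {x} → (∀ {y} → y ∈ W → y ⊩ a → y ⊩ b) → x ⊩ ¬ b → x ⊩ ¬ a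
    ⊩-¬-antitone _ _ a⇒b x¬b = tabulate λ y∈W ya → lookup x¬b y∈W (a⇒b y∈W ya)

    ⊩-¬¬-mono : ∀ a b {x} → (∀ {y} → y ∈ W → y ⊩ a → y ⊩ b) → x ⊩ ¬ ¬ a → x ⊩ ¬ ¬ b
    ⊩-¬¬-mono a b a⇒b = ⊩-¬-antitone (¬ b) (¬ a) (λ _ → ⊩-¬-antitone a b a⇒b)

    ⊩-¬¬-intro : ∀ {a x} → x ∈ W → x ⊩ a → x ⊩ ¬ ¬ a
    ⊩-¬¬-intro x∈W xa = tabulate λ y∈W y¬a → ⟂-sym (lookup y¬a x∈W xa)

    ⊩-mem : ∀ {a x} → x ∈ W → Not (x ⊩ □ a) → x ⊩ ¬ □ a
    ⊩-mem {a} {x} x∈W x⊮□a = tabulate ⟂-□a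
      where
      ⟂-□a : ∀ {z} → z ∈ W → z ⊩ □ a → x ⟂ z
      ⟂-□a z∈W z□a with ↝-⊆-or-⟂ x∈W z∈W
      ... | inj₁ ↝⊆  = ⊥-elim (x⊮□a (tabulate λ y∈W x↝y → lookup z□a y∈W (↝⊆ x↝y)))
      ... | inj₂ x⟂z = x⟂z

    ⊩-¬¬-elim : ∀ a {x} → x ∈ W → x ⊩ ¬ ¬ a → x ⊩ a
    ⊩-¬¬-elim (atom n) x∈W = atom-¬¬-closed x∈W
    ⊩-¬¬-elim (a ∧ b)  x∈W x¬¬ab =
      ⊩-¬¬-elim a x∈W (⊩-¬¬-mono (a ∧ b) a (λ _ → proj₁) x¬¬ab) ,
      ⊩-¬¬-elim b x∈W (⊩-¬¬-mono (a ∧ b) b (λ _ → proj₂) x¬¬ab)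
    ⊩-¬¬-elim (¬ a)    x∈W = ⊩-¬-antitone a (¬ ¬ a) (⊩-¬¬-intro {a})
    ⊩-¬¬-elim (□ a) {x} x∈W x¬¬□a with x ⊩? □ a
    ... | yes x□a  = x□a
    ... | no x⊮□a = ⊥-elim (⟂-irrefl x∈W (lookup x¬¬□a x∈W (⊩-mem {a} x∈W x⊮□a)))

    sound : ∀ {Γ Δ x} → Γ ⊢ Δ → x ∈ W → All (x ⊩_) Γ → Any (x ⊩_) Δ
    sound (set d Γ≋ Δ≋) x∈W xΓ = Any-resp-⊆ (≋⇒⊆ Δ≋) (sound d x∈W (All-resp-⊇ (≋⇒⊆ Γ≋) xΓ))
    sound ax x∈W (xα ∷ []) = here xα
    sound {x = x} (mem {α = a}) x∈W _ with x ⊩? □ a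
    ... | yes x□a  = here x□a
    ... | no x⊮□a = there (here (⊩-mem {a} x∈W x⊮□a))
    sound (wkn {Π = Π} d) x∈W xΓ = Anyₚ.++⁺ˡ (sound d x∈W (Allₚ.++⁻ʳ Π xΓ))
    sound (cut {Γ₁ = Γ₁} {Δ₁ = Δ₁} d e) x∈W xΓ with Any-∷ʳ⁻ Δ₁ (sound d x∈W (Allₚ.++⁻ˡ Γ₁ xΓ))
    ... | inj₁ xΔ₁ = Anyₚ.++⁺ˡ xΔ₁
    ... | inj₂ xα  = Anyₚ.++⁺ʳ Δ₁ (sound e x∈W (xα ∷ Allₚ.++⁻ʳ Γ₁ xΓ))
    sound (∧l₁ d) x∈W ((xa , _) ∷ xΓ) = sound d x∈W (xa ∷ xΓ)
    sound (∧l₂ d) x∈W ((_ , xb) ∷ xΓ) = sound d x∈W (xb ∷ xΓ)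
    sound (∧r {Δ = Δ} d e) x∈W xΓ with Any-∷ʳ⁻ Δ (sound d x∈W xΓ) | Any-∷ʳ⁻ Δ (sound e x∈W xΓ)
    ... | inj₁ xΔ | _       = Anyₚ.++⁺ˡ xΔ
    ... | inj₂ _  | inj₁ xΔ = Anyₚ.++⁺ˡ xΔ
    ... | inj₂ xa | inj₂ xb = Anyₚ.++⁺ʳ Δ (here (xa , xb))
    sound (¬l {Δ = Δ} d) x∈W (x¬a ∷ xΓ) with Any-∷ʳ⁻ Δ (sound d x∈W xΓ)
    ... | inj₁ xΔ = xΔ
    ... | inj₂ xa = ⊥-elim (⟂-irrefl x∈W (lookup x¬a x∈W xa))
    sound (¬r d) x∈W x¬Δ = here (tabulate λ y∈W ya →
      lookupWith (λ x¬δ yδ → lookup x¬δ y∈W yδ) (Allₚ.map⁻ x¬Δ) (sound d y∈W (ya ∷ [])))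
    sound (¬¬l {α = a} d) x∈W (x¬¬a ∷ xΓ) = sound d x∈W (⊩-¬¬-elim a x∈W x¬¬a ∷ xΓ)
    sound (¬¬r {α = a} {Δ = Δ} d) x∈W xΓ with Any-∷ʳ⁻ Δ (sound d x∈W xΓ)
    ... | inj₁ xΔ = Anyₚ.++⁺ˡ xΔ
    ... | inj₂ xa = Anyₚ.++⁺ʳ Δ (here (⊩-¬¬-intro {a} x∈W xa))
    sound (K d) x∈W x□Γ = here (tabulate λ y∈W x↝y →
      singleton⁻ (sound d y∈W (All.map (λ x□γ → lookup x□γ y∈W x↝y) (Allₚ.map⁻ x□Γ))))

Point : Set
Point = List Formula × List Formula

S T : Point → List Formula
S = proj₁
T = proj₂

infix 4 _⟂_ _⟂?_

_⟂_ : Point → Point → Set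
x ⟂ y = Any (λ ψ → ¬ ψ ∈ S x) (S y) ⊎ Any (λ ψ → ¬ ψ ∈ S y) (S x)

_⟂?_ : Decidable _⟂_
x ⟂? y = any? (λ ψ → ¬ ψ ∈? S x) (S y) ⊎-dec any? (λ ψ → ¬ ψ ∈? S y) (S x)

clash⇒⟂ : ∀ {ψ} x y → ¬ ψ ∈ S x → ψ ∈ S y → x ⟂ y
clash⇒⟂ _ _ ¬ψ∈Sx ψ∈Sy = inj₁ (lose ψ∈Sy ¬ψ∈Sx)

⟂⇒⊢¬* : ∀ {x y} → x ⟂ y → S y ⊢ ¬* (S x)
⟂⇒⊢¬* (inj₁ clash) with find clash
... | _ , ψ∈Sy , ¬ψ∈Sx = ⊢-select (¬¬r {Δ = []} ax) ψ∈Sy (∈-map⁺ ¬_ ¬ψ∈Sx)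
⟂⇒⊢¬* (inj₂ clash) with find clash
... | _ , ψ∈Sx , ¬ψ∈Sy = ⊢-init ¬ψ∈Sy (∈-map⁺ ¬_ ψ∈Sx)

module Canonical (C : List Formula) (C-closed : Closed C) where
  open Closed C-closed

  boxed : Point → List Formula
  boxed x = filter (λ ψ → □ ψ ∈? S x) C

  ∈-boxed⁻ : ∀ {ψ} x → ψ ∈ boxed x → ψ ∈ C × □ ψ ∈ S x
  ∈-boxed⁻ x = ∈-filter⁻ (λ ψ → □ ψ ∈? S x) {xs = C}

  ∈-boxed⁺ : ∀ {ψ} x → ψ ∈ C → □ ψ ∈ S x → ψ ∈ boxed x
  ∈-boxed⁺ x = ∈-filter⁺ (λ ψ → □ ψ ∈? S x)

  □boxed⊆S : ∀ x → □* (boxed x) ⊆ S x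
  □boxed⊆S x □ψ∈ with ∈-map⁻ □_ □ψ∈
  ... | _ , ψ∈ , refl = proj₂ (∈-boxed⁻ x ψ∈)

  infix 4 _↝_ _↝?_

  _↝_ : Point → Point → Set
  x ↝ y = All (_∈ S y) (boxed x)

  _↝?_ : Decidable _↝_
  x ↝? y = all? (_∈? S y) (boxed x)

  CoherentAt : List Point → Point → Formula → Set
  CoherentAt W x (atom n) = atom n ∈ S x ⊎ Any (λ y → ¬ atom n ∈ S y × Not (x ⟂ y)) W
  CoherentAt W x (a ∧ b)  = (a ∧ b ∈ S x → a ∈ S x × b ∈ S x) × (a ∈ S x → b ∈ S x → a ∧ b ∈ S x)
  CoherentAt W x (¬ a)    = (¬ a ∈ S x → a ∉ S x) × (¬ a ∈ S x ⊎ Any (λ y → a ∈ S y × Not (x ⟂ y)) W)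
  CoherentAt W x (□ a)    = (□ a ∈ S x ⊎ ¬ □ a ∈ S x) × (□ a ∈ S x ⊎ Any (λ y → x ↝ y × a ∉ S y) W)

  coherentAt? : ∀ W x φ → Dec (CoherentAt W x φ)
  coherentAt? W x (atom n) = atom n ∈? S x ⊎-dec any? (λ y → ¬ atom n ∈? S y ×-dec ¬? (x ⟂? y)) W
  coherentAt? W x (a ∧ b)  = (a ∧ b ∈? S x →-dec a ∈? S x ×-dec b ∈? S x)
                       ×-dec (a ∈? S x →-dec b ∈? S x →-dec a ∧ b ∈? S x)
  coherentAt? W x (¬ a)    = (¬ a ∈? S x →-dec ¬? (a ∈? S x))
                       ×-dec (¬ a ∈? S x ⊎-dec any? (λ y → a ∈? S y ×-dec ¬? (x ⟂? y)) W)
  coherentAt? W x (□ a)    = (□ a ∈? S x ⊎-dec ¬ □ a ∈? S x)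
                       ×-dec (□ a ∈? S x ⊎-dec any? (λ y → x ↝? y ×-dec ¬? (a ∈? S y)) W)

  Coherent : List Point → Point → Set
  Coherent W x = All (CoherentAt W x) C

  coherent? : ∀ W x → Dec (Coherent W x)
  coherent? W x = all? (coherentAt? W x) C

  Covers : List Point → Set
  Covers W = ∀ {y} → y ∈ splits C → y ∈ W ⊎ S y ⊢ T y

  module _ {W : List Point} (covers : Covers W) {x : Point} where

    ⊢¬-unwitnessed : ∀ {φ} → φ ∈ C → Not (Any (λ y → φ ∈ S y × Not (x ⟂ y)) W) → S x ⊢ ¬ φ ∷ []
    ⊢¬-unwitnessed {φ} φ∈C unwitnessed = contrapose (⊢-by-splits C branch)
      where
      branch : ∀ {y} → y ∈ splits C → φ ∷ S y ⊢ ¬* (S x) ++ T y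
      branch {y} y∈ with φ ∈? S y | x ⟂? y
      ... | no φ∉Sy | _      = ⊢-init (here refl) (∈-++⁺ʳ _ (splits-∉₁⇒∈₂ y∈ φ∈C φ∉Sy))
      ... | yes _   | yes x⟂y = ⊢-mono (⟂⇒⊢¬* {x} {y} x⟂y) there ∈-++⁺ˡ
      ... | yes φ∈Sy | no x⟂̸y with covers y∈
      ...   | inj₁ y∈W = ⊥-elim (unwitnessed (lose y∈W (φ∈Sy , x⟂̸y)))
      ...   | inj₂ ⊢y  = ⊢-mono ⊢y there (∈-++⁺ʳ _)

    ⊢□-unwitnessed : ∀ {a} → Not (Any (λ y → x ↝ y × a ∉ S y) W) → S x ⊢ □ a ∷ []
    ⊢□-unwitnessed {a} unwitnessed = ⊢-mono (K (⊢-by-splits C branch)) (□boxed⊆S x) id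
      where
      branch : ∀ {y} → y ∈ splits C → boxed x ++ S y ⊢ a ∷ T y
      branch {y} y∈ with x ↝? y | a ∈? S y
      ... | no x↝̸y | _ with find (¬All⇒Any¬ (_∈? S y) (boxed x) x↝̸y)
      ...   | ψ , ψ∈boxed , ψ∉Sy =
        ⊢-init (∈-++⁺ˡ ψ∈boxed) (there (splits-∉₁⇒∈₂ y∈ (proj₁ (∈-boxed⁻ x ψ∈boxed)) ψ∉Sy))
      branch {y} y∈ | yes _   | yes a∈Sy = ⊢-init (∈-++⁺ʳ _ a∈Sy) (here refl)
      branch {y} y∈ | yes x↝y | no a∉Sy with covers y∈
      ...   | inj₁ y∈W = ⊥-elim (unwitnessed (lose y∈W (x↝y , a∉Sy)))
      ...   | inj₂ ⊢y  = ⊢-mono ⊢y (∈-++⁺ʳ _) there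

    module _ (x∈ : x ∈ splits C) where

      ∈T : ∀ {φ} → φ ∈ C → φ ∉ S x → φ ∈ T x
      ∈T = splits-∉₁⇒∈₂ x∈

      ⊢-into-T : ∀ {φ} → S x ⊢ φ ∷ [] → φ ∈ C → φ ∉ S x → S x ⊢ T x
      ⊢-into-T ⊢φ φ∈C φ∉Sx = ⊢-mono ⊢φ id (λ { (here refl) → ∈T φ∈C φ∉Sx })

      incoherentAt⇒⊢ : ∀ φ → φ ∈ C → Not (CoherentAt W x φ) → S x ⊢ T x
      incoherentAt⇒⊢ (atom n) φ∈C incoherent =
        ⊢-into-T (¬¬-elimʳ (⊢¬-unwitnessed (¬atom-closed φ∈C) (incoherent ∘ inj₂)))
                 φ∈C (incoherent ∘ inj₁)
      incoherentAt⇒⊢ (a ∧ b) φ∈C incoherent with a ∧ b ∈? S x | a ∈? S x | b ∈? S x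
      ... | yes ab∈ | no a∉  | _      = ⊢-select (∧l₁ {Γ = []} ax) ab∈ (∈T (∧-closedˡ φ∈C) a∉)
      ... | yes ab∈ | yes _  | no b∉ = ⊢-select (∧l₂ {Γ = []} ax) ab∈ (∈T (∧-closedʳ φ∈C) b∉)
      ... | yes ab∈ | yes a∈ | yes b∈ = ⊥-elim (incoherent ((λ _ → a∈ , b∈) , (λ _ _ → ab∈)))
      ... | no ab∉  | yes a∈ | yes b∈ =
        ⊢-into-T (∧r {Δ = []} (⊢-init a∈ (here refl)) (⊢-init b∈ (here refl))) φ∈C ab∉
      ... | no ab∉  | no a∉  | _      =
        ⊥-elim (incoherent ((⊥-elim ∘ ab∉) , (λ a∈ → ⊥-elim (a∉ a∈))))
      ... | no ab∉  | yes _  | no b∉ =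
        ⊥-elim (incoherent ((⊥-elim ∘ ab∉) , (λ _ b∈ → ⊥-elim (b∉ b∈))))
      incoherentAt⇒⊢ (¬ a) φ∈C incoherent with ¬ a ∈? S x | a ∈? S x
      ... | yes ¬a∈ | yes a∈ = ⊢-mono (¬l {Γ = a ∷ []} {Δ = []} ax)
                                       (λ { (here refl) → ¬a∈ ; (there (here refl)) → a∈ }) (λ ())
      ... | yes ¬a∈ | no a∉  = ⊥-elim (incoherent ((λ _ → a∉) , inj₁ ¬a∈))
      ... | no ¬a∉  | _      =
        ⊢-into-T (⊢¬-unwitnessed (¬-closed φ∈C) (λ w → incoherent ((⊥-elim ∘ ¬a∉) , inj₂ w)))
                 φ∈C ¬a∉
      incoherentAt⇒⊢ (□ a) φ∈C incoherent with □ a ∈? S x | ¬ □ a ∈? S x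
      ... | yes □a∈ | _       = ⊥-elim (incoherent (inj₁ □a∈ , inj₁ □a∈))
      ... | no □a∉  | no ¬□a∉ = ⊢-mono (mem {Γ = []}) (λ ())
        (λ { (here refl) → ∈T φ∈C □a∉ ; (there (here refl)) → ∈T (¬□-closed φ∈C) ¬□a∉ })
      ... | no □a∉  | yes ¬□a∈ =
        ⊢-into-T (⊢□-unwitnessed (λ w → incoherent (inj₂ ¬□a∈ , inj₂ w))) φ∈C □a∉

      incoherent⇒⊢ : Not (Coherent W x) → S x ⊢ T x
      incoherent⇒⊢ incoherent with find (¬All⇒Any¬ (coherentAt? W x) C incoherent)
      ... | φ , φ∈C , incoherentAt = incoherentAt⇒⊢ φ φ∈C incoherentAt

  prune : List Point → List Point
  prune W = filter (coherent? W) W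

  prune-covers : ∀ {W} → Covers W → Covers (prune W)
  prune-covers {W} covers {y} y∈ with covers y∈
  ... | inj₂ ⊢y  = inj₂ ⊢y
  ... | inj₁ y∈W with coherent? W y
  ...   | yes coherent   = inj₁ (∈-filter⁺ (coherent? W) y∈W coherent)
  ...   | no incoherent = inj₂ (incoherent⇒⊢ covers y∈ incoherent)

  record Stable (W : List Point) : Set where
    field
      ⊆splits  : W ⊆ splits C
      covers   : Covers W
      coherent : All (Coherent W) W

  stabilise : ∀ n W → length W < n → W ⊆ splits C → Covers W → ∃ Stable
  stabilise (suc n) W |W|<1+n W⊆ covers with all? (coherent? W) W
  ... | yes coherent   = W , record { ⊆splits = W⊆ ; covers = covers ; coherent = coherent }
  ... | no incoherent =
    stabilise n (prune W) (<-≤-trans shrinks (s≤s⁻¹ |W|<1+n))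
              (W⊆ ∘ proj₁ ∘ ∈-filter⁻ (coherent? W)) (prune-covers covers)
    where
    shrinks : length (prune W) < length W
    shrinks = filter-notAll (coherent? W) W (¬All⇒Any¬ (coherent? W) W incoherent)

  stable : ∃ Stable
  stable = stabilise (suc (length (splits C))) (splits C) ≤-refl id inj₁

  module Model {W : List Point} (st : Stable W) where
    open Stable st

    open Semantics W _⟂_ _↝_ (λ n x → atom n ∈ S x)

    coherentAt : ∀ {x φ} → x ∈ W → φ ∈ C → CoherentAt W x φ
    coherentAt x∈W = lookup (lookup coherent x∈W)

    S⊆C : ∀ {x} → x ∈ W → S x ⊆ C
    S⊆C x∈W = splits-⊆ (⊆splits x∈W)

    ⟂-irrefl : ∀ {x} → x ∈ W → Not (x ⟂ x)
    ⟂-irrefl x∈W x⟂x with find (reduce x⟂x)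
    ... | _ , ψ∈Sx , ¬ψ∈Sx = proj₁ (coherentAt x∈W (S⊆C x∈W ¬ψ∈Sx)) ¬ψ∈Sx ψ∈Sx

    boxed-⊆-or-⟂ : ∀ {x z} → x ∈ W → z ∈ W → All (_∈ boxed x) (boxed z) ⊎ x ⟂ z
    boxed-⊆-or-⟂ {x} {z} x∈W z∈W = All-⊎-const (tabulate shared-or-⟂)
      where
      shared-or-⟂ : ∀ {ψ} → ψ ∈ boxed z → ψ ∈ boxed x ⊎ x ⟂ z
      shared-or-⟂ ψ∈ with ∈-boxed⁻ z ψ∈
      ... | ψ∈C , □ψ∈Sz with proj₁ (coherentAt x∈W (S⊆C z∈W □ψ∈Sz))
      ...   | inj₁ □ψ∈Sx  = inj₁ (∈-boxed⁺ x ψ∈C □ψ∈Sx)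
      ...   | inj₂ ¬□ψ∈Sx = inj₂ (clash⇒⟂ x z ¬□ψ∈Sx □ψ∈Sz)

    atom-¬¬-closed : ∀ {n x} → x ∈ W → x ⊩ ¬ ¬ atom n → atom n ∈ S x
    atom-¬¬-closed {n} {x} x∈W x¬¬p with atom n ∈? C
    ... | no p∉C = ⊥-elim (⟂-irrefl x∈W (lookup x¬¬p x∈W x¬p))
      where
      x¬p : x ⊩ ¬ atom n
      x¬p = tabulate λ z∈W p∈Sz → ⊥-elim (p∉C (S⊆C z∈W p∈Sz))
    ... | yes p∈C with coherentAt x∈W p∈C
    ...   | inj₁ p∈Sx = p∈Sx
    ...   | inj₂ witness with find witness
    ...     | y , y∈W , ¬p∈Sy , x⟂̸y =
      ⊥-elim (x⟂̸y (lookup x¬¬p y∈W (tabulate λ {z} _ p∈Sz → clash⇒⟂ y z ¬p∈Sy p∈Sz)))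

    isOrthoModel : IsOrthoModel
    isOrthoModel = record
      { _⟂?_           = _⟂?_
      ; _↝?_           = _↝?_
      ; V?             = λ n x → atom n ∈? S x
      ; ⟂-sym          = Sum.swap
      ; ⟂-irrefl       = ⟂-irrefl
      ; ↝-⊆-or-⟂       = λ x∈W z∈W → Sum.map₁ (λ ⊆x x↝y → All-resp-⊇ (lookup ⊆x) x↝y)
                                               (boxed-⊆-or-⟂ x∈W z∈W)
      ; atom-¬¬-closed = atom-¬¬-closed
      }

    truth : ∀ φ {x} → x ∈ W → φ ∈ C → (x ⊩ φ) ⇔ (φ ∈ S x)
    truth (atom n) x∈W φ∈C = mk⇔ id id
    truth (a ∧ b) x∈W φ∈C =
      mk⇔ (λ (xa , xb) → proj₂ coh (to ta xa) (to tb xb))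
          (λ ab∈ → from ta (proj₁ (proj₁ coh ab∈)) , from tb (proj₂ (proj₁ coh ab∈)))
      where
      coh = coherentAt x∈W φ∈C
      ta = truth a x∈W (∧-closedˡ φ∈C)
      tb = truth b x∈W (∧-closedʳ φ∈C)
    truth (¬ a) {x} x∈W φ∈C =
      mk⇔ ⊩¬⇒∈ (λ ¬a∈ → tabulate λ {y} y∈W ya → clash⇒⟂ x y ¬a∈ (to (ta y∈W) ya))
      where
      ta : ∀ {y} → y ∈ W → (y ⊩ a) ⇔ (a ∈ S y)
      ta y∈W = truth a y∈W (¬-closed φ∈C)
      ⊩¬⇒∈ : x ⊩ ¬ a → ¬ a ∈ S x
      ⊩¬⇒∈ x¬a with proj₂ (coherentAt x∈W φ∈C)
      ... | inj₁ ¬a∈ = ¬a∈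
      ... | inj₂ witness with find witness
      ...   | _ , y∈W , a∈Sy , x⟂̸y = ⊥-elim (x⟂̸y (lookup x¬a y∈W (from (ta y∈W) a∈Sy)))
    truth (□ a) {x} x∈W φ∈C =
      mk⇔ ⊩□⇒∈ (λ □a∈ → tabulate λ y∈W x↝y →
                  from (ta y∈W) (lookup x↝y (∈-boxed⁺ x (□-closed φ∈C) □a∈)))
      where
      ta : ∀ {y} → y ∈ W → (y ⊩ a) ⇔ (a ∈ S y)
      ta y∈W = truth a y∈W (□-closed φ∈C)
      ⊩□⇒∈ : x ⊩ □ a → □ a ∈ S x
      ⊩□⇒∈ x□a with proj₂ (coherentAt x∈W φ∈C)
      ... | inj₁ □a∈ = □a∈
      ... | inj₂ witness with find witness
      ...   | _ , y∈W , x↝y , a∉Sy = ⊥-elim (a∉Sy (to (ta y∈W) (lookup x□a y∈W x↝y)))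

    ⊢-if-everywhere : ∀ {α} → All (λ x → α ∈ S x) W → [] ⊢ α ∷ []
    ⊢-if-everywhere {α} everywhere = ⊢-by-splits C branch
      where
      branch : ∀ {y} → y ∈ splits C → S y ⊢ α ∷ T y
      branch {y} y∈ with α ∈? S y | covers y∈
      ... | yes α∈Sy | _        = ⊢-init α∈Sy (here refl)
      ... | no α∉Sy  | inj₁ y∈W = ⊥-elim (α∉Sy (lookup everywhere y∈W))
      ... | no _     | inj₂ ⊢y  = ⊢-mono ⊢y id there

    ⊬-if-missing : ∀ {α x} → x ∈ W → α ∈ C → α ∉ S x → Not ([] ⊢ α ∷ [])
    ⊬-if-missing {α} x∈W α∈C α∉Sx ⊢α =
      α∉Sx (to (truth α x∈W α∈C) (singleton⁻ (sound isOrthoModel ⊢α x∈W [])))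

    decide : ∀ {α} → α ∈ C → Dec ([] ⊢ α ∷ [])
    decide {α} α∈C with all? (λ x → α ∈? S x) W
    ... | yes everywhere = yes (⊢-if-everywhere everywhere)
    ... | no missing with find (¬All⇒Any¬ (λ x → α ∈? S x) W missing)
    ...   | _ , x∈W , α∉Sx = no (⊬-if-missing x∈W α∈C α∉Sx)

theorem1 : (α : Formula) → Dec ([] ⊢ (α ∷ []))
theorem1 α = Model.decide (proj₂ stable) (closure-self α)
  where open Canonical (closure α) (closure-closed α)
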